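{- (Generation lemma on abstraction for conversion.) For every environment $C$ and terms $V_1,V_2,T_1,T_2$ and variable $x$: if $C\vdash \lambda x{:}V_1.T_1 \Leftrightarrow \lambda x{:}V_2.T_2$, then $C\vdash V_1\Leftrightarrow V_2$ and, for every term $V$, $C.\lambda x{:}V\vdash T_1\Leftrightarrow T_2$.
   Context: Terms of the calculus $\lambda\delta$: $T ::= \ast h \mid x \mid \lambda x{:}W.\,T \mid \delta x{=}V.\,T \mid \mathrm{appl}(V,T) \mid \mathrm{cast}(W,T)$ ($h\in\mathbb N$, $x$ a variable); $\ast h$ is a sort, $\lambda x{:}W.T$ abstraction over type $W$, $\delta x{=}V.T$ the abbreviation "let $x=V$ in $T$", $\mathrm{appl}(V,T)$ application of $T$ to argument $V$, $\mathrm{cast}(W,T)$ $T$ annotated with type $W$. In $\lambda x{:}W.T$, $\delta x{=}V.T$, $x$ is bound in $T$ only; $\mathrm{FV}(T)$ free variables; terms up to renaming of bound variables with bound and free names disjoint. Environments: $E ::= \ast h \mid \lambda x{:}W.E \mid \delta x{=}V.E \mid \mathrm{appl}(V,E)\mid\mathrm{cast}(W,E)$ (finite sequences of items terminated by a sort). $E.\lambda x{:}W$ (resp. $E.\delta x{=}V$) denotes the environment obtained from $E$ by replacing its terminal sort $\ast h$ by $\lambda x{:}W.\ast h$ (resp. $\delta x{=}V.\ast h$). $E=C_1\cdot\delta x{=}V\cdot C_2$ means $E$ is obtained from the environment $C_1$ by replacing its terminal sort with $\delta x{=}V.C_2$ for some environment $C_2$. Strict substitution: $T[x:=^+W]\,T'$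 iff $x\notin\mathrm{FV}(W)$, $x\in\mathrm{FV}(T)$ and $T'$ arises from $T$ by replacing a nonempty set of free occurrences of $x$ by $W$. Environment-free parallel reduction $\to_0$: least relation closed under (refl) $T\to_0T$; (compatibility) if $A_1\to_0A_2$, $T_1\to_0T_2$ then $\lambda x{:}A_1.T_1\to_0\lambda x{:}A_2.T_2$, $\delta x{=}A_1.T_1\to_0\delta x{=}A_2.T_2$, $\mathrm{appl}(A_1,T_1)\to_0\mathrm{appl}(A_2,T_2)$, $\mathrm{cast}(A_1,T_1)\to_0\mathrm{cast}(A_2,T_2)$; ($\beta$) if $V_1\to_0V_2$, $T_1\to_0T_2$ then $\mathrm{appl}(V_1,\lambda x{:}W.T_1)\to_0\delta x{=}V_2.T_2$; ($\delta$) if $V_1\to_0V_2$, $T_1\to_0T_2$, $T_2[x:=^+V_2]T$ then $\delta x{=}V_1.T_1\to_0\delta x{=}V_2.T$; ($\zeta$) if $T_1\to_0T_2$, $x\notin\mathrm{FV}(T_1)$ then $\delta x{=}V.T_1\to_0T_2$; ($\tau$) if $T_1\to_0T_2$ then $\mathrm{cast}(W,T_1)\to_0T_2$; ($\upsilon$) if $V_1\to_0V_3$, $V_2\to_0V_4$, $T_1\to_0T_2$ then $\mathrm{appl}(V_1,\delta x{=}V_2.T_1)\to_0\delta x{=}V_4.\mathrm{appl}(V_3,T_2)$. $E\vdash T_1\to T_2$ iff $T_1\to_0T_2$, or $E=C_1\cdot\delta x{=}V\cdot C_2$, $T_1\to_0T'$ and $T'[x:=^+V]T_2$ for some $C_1,C_2,x,V,T'$.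 Conversion $E\vdash T_1\Leftrightarrow T_2$ is the symmetric and transitive closure of $E\vdash\cdot\to\cdot$. -}

module Defs where

-- The calculus λδ, rendered with de Bruijn indices (terms up to renaming of
-- bound variables).

open import Data.Nat using (ℕ; zero; suc; _+_; _<ᵇ_)
open import Data.Bool using (if_then_else_)
open import Relation.Binary.PropositionalEquality using (_≡_)

data Term : Set where
  sort : ℕ → Term
  lref : ℕ → Term
  abst : Term → Term → Term       -- λ x:W. T   (x is index 0 in T)
  abbr : Term → Term → Term       -- δ x=V. T   (x is index 0 in T)
  appl : Term → Term → Term
  cast : Term → Term → Term

lift : ℕ → ℕ → Term → Term
lift d k (sort h)   = sort h
lift d k (lref i)   = if i <ᵇ k then lref i else lref (i + d)
lift d k (abst W T) = abst (lift d k W) (lift d (suc k) T)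
lift d k (abbr V T) = abbr (lift d k V) (lift d (suc k) T)
lift d k (appl V T) = appl (lift d k V) (lift d k T)
lift d k (cast W T) = cast (lift d k W) (lift d k T)

-- Replacement of a (possibly empty) set of free occurrences of variable i
-- by W (W is given relative to the current binding depth).
data PSubst : ℕ → Term → Term → Term → Set where
  ps-sort : ∀ {i W h} → PSubst i W (sort h) (sort h)
  ps-keep : ∀ {i W j} → PSubst i W (lref j) (lref j)
  ps-repl : ∀ {i W} → PSubst i W (lref i) W
  ps-abst : ∀ {i W A A' T T'} → PSubst i W A A' →
            PSubst (suc i) (lift 1 0 W) T T' → PSubst i W (abst A T) (abst A' T')
  ps-abbr : ∀ {i W A A' T T'} → PSubst i W A A' →
            PSubst (suc i) (lift 1 0 W) T T' → PSubst i W (abbr A T) (abbr A' T')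
  ps-appl : ∀ {i W A A' T T'} → PSubst i W A A' →
            PSubst i W T T' → PSubst i W (appl A T) (appl A' T')
  ps-cast : ∀ {i W A A' T T'} → PSubst i W A A' →
            PSubst i W T T' → PSubst i W (cast A T) (cast A' T')

-- Strict substitution T[x :=⁺ W] T' : a NONEMPTY set of free occurrences of
-- variable i is replaced by W.
data SSubst : ℕ → Term → Term → Term → Set where
  ss-repl  : ∀ {i W} → SSubst i W (lref i) W
  ss-abstˡ : ∀ {i W A A' T T'} → SSubst i W A A' →
             PSubst (suc i) (lift 1 0 W) T T' → SSubst i W (abst A T) (abst A' T')
  ss-abstʳ : ∀ {i W A A' T T'} → PSubst i W A A' →
             SSubst (suc i) (lift 1 0 W) T T' → SSubst i W (abst A T) (abst A' T')
  ss-abbrˡ : ∀ {i W A A' T T'} → SSubst i W A A' →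
             PSubst (suc i) (lift 1 0 W) T T' → SSubst i W (abbr A T) (abbr A' T')
  ss-abbrʳ : ∀ {i W A A' T T'} → PSubst i W A A' →
             SSubst (suc i) (lift 1 0 W) T T' → SSubst i W (abbr A T) (abbr A' T')
  ss-applˡ : ∀ {i W A A' T T'} → SSubst i W A A' →
             PSubst i W T T' → SSubst i W (appl A T) (appl A' T')
  ss-applʳ : ∀ {i W A A' T T'} → PSubst i W A A' →
             SSubst i W T T' → SSubst i W (appl A T) (appl A' T')
  ss-castˡ : ∀ {i W A A' T T'} → SSubst i W A A' →
             PSubst i W T T' → SSubst i W (cast A T) (cast A' T')
  ss-castʳ : ∀ {i W A A' T T'} → PSubst i W A A' →
             SSubst i W T T' → SSubst i W (cast A T) (cast A' T')

infix 4 _→₀_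
data _→₀_ : Term → Term → Set where
  r-refl : ∀ {T} → T →₀ T
  r-abst : ∀ {A₁ A₂ T₁ T₂} → A₁ →₀ A₂ → T₁ →₀ T₂ → abst A₁ T₁ →₀ abst A₂ T₂
  r-abbr : ∀ {A₁ A₂ T₁ T₂} → A₁ →₀ A₂ → T₁ →₀ T₂ → abbr A₁ T₁ →₀ abbr A₂ T₂
  r-appl : ∀ {A₁ A₂ T₁ T₂} → A₁ →₀ A₂ → T₁ →₀ T₂ → appl A₁ T₁ →₀ appl A₂ T₂
  r-cast : ∀ {A₁ A₂ T₁ T₂} → A₁ →₀ A₂ → T₁ →₀ T₂ → cast A₁ T₁ →₀ cast A₂ T₂
  r-beta : ∀ {V₁ V₂ W T₁ T₂} → V₁ →₀ V₂ → T₁ →₀ T₂ →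
           appl V₁ (abst W T₁) →₀ abbr V₂ T₂
  r-delta : ∀ {V₁ V₂ T₁ T₂ T} → V₁ →₀ V₂ → T₁ →₀ T₂ →
            SSubst 0 (lift 1 0 V₂) T₂ T → abbr V₁ T₁ →₀ abbr V₂ T
  -- (ζ) δx=V.T₁ →₀ T₂  when x ∉ FV(T₁)  (T₁ is the lift of some U₁)
  r-zeta : ∀ {V U₁ T₂} → U₁ →₀ T₂ → abbr V (lift 1 0 U₁) →₀ T₂
  r-tau  : ∀ {W T₁ T₂} → T₁ →₀ T₂ → cast W T₁ →₀ T₂
  r-upsilon : ∀ {V₁ V₂ V₃ V₄ T₁ T₂} → V₁ →₀ V₃ → V₂ →₀ V₄ → T₁ →₀ T₂ →
              appl V₁ (abbr V₂ T₁) →₀ abbr V₄ (appl (lift 1 0 V₃) T₂)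

data Env : Set where
  esort : ℕ → Env
  eabst : Term → Env → Env
  eabbr : Term → Env → Env
  eappl : Term → Env → Env
  ecast : Term → Env → Env

plug : Env → Env → Env
plug (esort h)   F = F
plug (eabst W E) F = eabst W (plug E F)
plug (eabbr V E) F = eabbr V (plug E F)
plug (eappl V E) F = eappl V (plug E F)
plug (ecast W E) F = ecast W (plug E F)

terminal : Env → ℕ
terminal (esort h)   = h
terminal (eabst _ E) = terminal E
terminal (eabbr _ E) = terminal E
terminal (eappl _ E) = terminal E
terminal (ecast _ E) = terminal E

_·λ_ : Env → Term → Env
E ·λ W = plug E (eabst W (esort (terminal E)))

_·δ_·_ : Env → Term → Env → Env
C₁ ·δ V · C₂ = plug C₁ (eabbr V C₂)

binders : Env → ℕ
binders (esort _)   = 0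
binders (eabst _ E) = suc (binders E)
binders (eabbr _ E) = suc (binders E)
binders (eappl _ E) = binders E
binders (ecast _ E) = binders E

data _⊢_⟶_ (E : Env) : Term → Term → Set where
  red-free : ∀ {T₁ T₂} → T₁ →₀ T₂ → E ⊢ T₁ ⟶ T₂
  red-env  : ∀ {C₁ C₂ V T₁ T' T₂} → E ≡ C₁ ·δ V · C₂ → T₁ →₀ T' →
             SSubst (binders C₂) (lift (suc (binders C₂)) 0 V) T' T₂ →
             E ⊢ T₁ ⟶ T₂

data _⊢_⇔_ (E : Env) : Term → Term → Set where
  cv-step  : ∀ {T₁ T₂} → E ⊢ T₁ ⟶ T₂ → E ⊢ T₁ ⇔ T₂
  cv-sym   : ∀ {T₁ T₂} → E ⊢ T₁ ⇔ T₂ → E ⊢ T₂ ⇔ T₁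
  cv-trans : ∀ {T₁ T₂ T₃} → E ⊢ T₁ ⇔ T₂ → E ⊢ T₂ ⇔ T₃ → E ⊢ T₁ ⇔ T₃

{-# OPTIONS --safe #-}
module Submission where

-- Conversion is analysed through a parallel reduction Par Γ in a context Γ of
-- de Bruijn entries, which may also unfold δ-bound variables.  Every step of
-- E ⊢ · ⟶ · is a finite Par (ctx E)-reduction and every Par (ctx E)-step is an
-- E-conversion, so E-conversion is the equivalence closure of Par (ctx E).
-- Par has the triangle property with respect to complete developments
-- (Takahashi), hence is confluent, and convertible terms have a common
-- Par-reduct.  Par reduces an abstraction only componentwise, so a common
-- reduct of λV₁.T₁ and λV₂.T₂ yields common reducts of V₁, V₂ in ctx C and of
-- T₁, T₂ in ctx C extended by a λ-entry; the type of that λ-entry is never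
-- inspected, which is why any V may be chosen in C.λx:V.

open import Defs
open import Data.Bool using (if_then_else_)
open import Data.Bool.Properties using (if-float)
open import Data.Empty using (⊥-elim)
open import Data.List using (List; []; _∷_)
open import Data.Maybe using (Maybe; just; nothing; zipWith) renaming (map to mapMaybe)
open import Data.Maybe.Properties using (just-injective)
open import Data.Nat using (ℕ; zero; suc; _+_; _≤_; _<_; z≤n; s≤s; _<ᵇ_)
open import Data.Nat.Induction using (<-wellFounded)
open import Data.Nat.Properties using (+-assoc; +-comm; +-suc; +-identityʳ; m≤m+n; m≤n+m; <-trans)
open import Data.Product using (∃; ∃-syntax; _×_; _,_)
open import Data.Sum using (_⊎_; inj₁; inj₂) renaming (map₁ to mapˡ)
open import Function using (_∘_; case_of_)
open import Induction.WellFounded using (Acc; acc)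
open import Relation.Binary.Core using (Rel)
open import Relation.Binary.Structures using (IsEquivalence)
open import Relation.Binary.Rewriting using (Confluent)
open import Relation.Binary.Construct.Closure.ReflexiveTransitive as Star
  using (Star; ε; _◅_; _◅◅_)
open import Relation.Binary.Construct.Closure.Symmetric using (fwd; bwd)
open import Relation.Binary.Construct.Closure.Equivalence as EqClosure
  using (EqClosure; _⋆)
open import Relation.Binary.Construct.Closure.Equivalence.Properties
  using (a—↠b⇒a↔b; a—↠b⇒b↔a)
open import Relation.Nullary using (¬_; Dec; yes; no)
open import Relation.Binary.PropositionalEquality
  using (_≡_; refl; sym; trans; cong; cong₂; subst; subst₂; module ≡-Reasoning)

private variable
  h i j k : ℕ
  A A' B D T T' T* T₁ T₂ U U' V V' V₁ V₂ W W' X : Term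
  E : Env

module _ {a ℓ} {A : Set a} {_⟶_ : Rel A ℓ} where

  diamond⇒confluent : (∀ {x y z} → x ⟶ y → x ⟶ z → ∃ λ w → y ⟶ w × z ⟶ w) → Confluent _⟶_
  diamond⇒confluent ◇ = confluent
    where
    strip : ∀ {x y z} → x ⟶ y → Star _⟶_ x z → ∃ λ w → Star _⟶_ y w × z ⟶ w
    strip r ε = _ , ε , r
    strip r (r' ◅ rs) with ◇ r r'
    ... | _ , s , s' with strip s' rs
    ... | w , ss , t = w , s ◅ ss , t

    confluent : Confluent _⟶_
    confluent ε rs = _ , rs , ε
    confluent (r ◅ rs) rs' with strip r rs'
    ... | _ , rs'' , r' with confluent rs rs''
    ... | w , t , t' = w , t , r' ◅ t'

  church-rosser : Confluent _⟶_ → ∀ {x y} → EqClosure _⟶_ x y →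
                  ∃ λ z → Star _⟶_ x z × Star _⟶_ y z
  church-rosser conf ε = _ , ε , ε
  church-rosser conf (fwd r ◅ rs) with church-rosser conf rs
  ... | z , s , t = z , r ◅ s , t
  church-rosser conf (bwd r ◅ rs) with church-rosser conf rs
  ... | z , s , t with conf (r ◅ ε) s
  ... | w , u , v = w , u , t ◅◅ v

liftVar : ℕ → ℕ → ℕ → ℕ
liftVar d zero    i       = d + i
liftVar d (suc k) zero    = zero
liftVar d (suc k) (suc i) = suc (liftVar d k i)

if-liftVar : ∀ d k i → (if i <ᵇ k then i else i + d) ≡ liftVar d k i
if-liftVar d zero    i       = +-comm i d
if-liftVar d (suc k) zero    = refl
if-liftVar d (suc k) (suc i) = trans (sym (if-float suc (i <ᵇ k))) (cong suc (if-liftVar d k i))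

lift-lref : ∀ d k i → lift d k (lref i) ≡ lref (liftVar d k i)
lift-lref d k i = trans (sym (if-float lref (i <ᵇ k))) (cong lref (if-liftVar d k i))

lift-lift-lref : ∀ d k d' k' i → lift d k (lift d' k' (lref i)) ≡ lref (liftVar d k (liftVar d' k' i))
lift-lift-lref d k d' k' i = trans (cong (lift d k) (lift-lref d' k' i)) (lift-lref d k _)

liftVar-liftVar : ∀ d m k i → liftVar d k (liftVar m k i) ≡ liftVar (d + m) k i
liftVar-liftVar d m zero    i       = sym (+-assoc d m i)
liftVar-liftVar d m (suc k) zero    = refl
liftVar-liftVar d m (suc k) (suc i) = cong suc (liftVar-liftVar d m k i)

lift-lift : ∀ d m k T → lift d k (lift m k T) ≡ lift (d + m) k T
lift-lift d m k (sort h)   = refl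
lift-lift d m k (lref i)   = trans (lift-lift-lref d k m k i)
  (trans (cong lref (liftVar-liftVar d m k i)) (sym (lift-lref (d + m) k i)))
lift-lift d m k (abst W T) = cong₂ abst (lift-lift d m k W) (lift-lift d m (suc k) T)
lift-lift d m k (abbr V T) = cong₂ abbr (lift-lift d m k V) (lift-lift d m (suc k) T)
lift-lift d m k (appl V T) = cong₂ appl (lift-lift d m k V) (lift-lift d m k T)
lift-lift d m k (cast W T) = cong₂ cast (lift-lift d m k W) (lift-lift d m k T)

liftVar-comm-shift : ∀ d j k i → j ≤ k → liftVar d (suc k) (liftVar 1 j i) ≡ liftVar 1 j (liftVar d k i)
liftVar-comm-shift d zero    k       i       _       = refl
liftVar-comm-shift d (suc j) (suc k) zero    _       = refl
liftVar-comm-shift d (suc j) (suc k) (suc i) (s≤s p) = cong suc (liftVar-comm-shift d j k i p)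

lift-comm-shift : ∀ d j k T → j ≤ k → lift d (suc k) (lift 1 j T) ≡ lift 1 j (lift d k T)
lift-comm-shift d j k (sort h)   p = refl
lift-comm-shift d j k (lref i)   p = trans (lift-lift-lref d (suc k) 1 j i)
  (trans (cong lref (liftVar-comm-shift d j k i p)) (sym (lift-lift-lref 1 j d k i)))
lift-comm-shift d j k (abst W T) p =
  cong₂ abst (lift-comm-shift d j k W p) (lift-comm-shift d (suc j) (suc k) T (s≤s p))
lift-comm-shift d j k (abbr V T) p =
  cong₂ abbr (lift-comm-shift d j k V p) (lift-comm-shift d (suc j) (suc k) T (s≤s p))
lift-comm-shift d j k (appl V T) p = cong₂ appl (lift-comm-shift d j k V p) (lift-comm-shift d j k T p)
lift-comm-shift d j k (cast W T) p = cong₂ cast (lift-comm-shift d j k W p) (lift-comm-shift d j k T p)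

lift-comm-shift₀ : ∀ d k T → lift d (suc k) (lift 1 0 T) ≡ lift 1 0 (lift d k T)
lift-comm-shift₀ d k T = lift-comm-shift d 0 k T z≤n

size : Term → ℕ
size (sort h)   = 1
size (lref i)   = 1
size (abst W T) = suc (size W + size T)
size (abbr V T) = suc (size V + size T)
size (appl V T) = suc (size V + size T)
size (cast W T) = suc (size W + size T)

size-lift : ∀ d k T → size (lift d k T) ≡ size T
size-lift d k (sort h)   = refl
size-lift d k (lref i)   = cong size (lift-lref d k i)
size-lift d k (abst W T) = cong₂ (λ m n → suc (m + n)) (size-lift d k W) (size-lift d (suc k) T)
size-lift d k (abbr V T) = cong₂ (λ m n → suc (m + n)) (size-lift d k V) (size-lift d (suc k) T)
size-lift d k (appl V T) = cong₂ (λ m n → suc (m + n)) (size-lift d k V) (size-lift d k T)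
size-lift d k (cast W T) = cong₂ (λ m n → suc (m + n)) (size-lift d k W) (size-lift d k T)

m<1+m+n : ∀ m n → m < suc (m + n)
m<1+m+n m n = s≤s (m≤m+n m n)

n<1+m+n : ∀ m n → n < suc (m + n)
n<1+m+n m n = s≤s (m≤n+m n m)

-- Strengthening: the partial inverse of lift 1 k

unliftVar : ℕ → ℕ → Maybe ℕ
unliftVar zero    zero    = nothing
unliftVar zero    (suc i) = just i
unliftVar (suc k) zero    = just zero
unliftVar (suc k) (suc i) = mapMaybe suc (unliftVar k i)

unlift : ℕ → Term → Maybe Term
unlift k (sort h)   = just (sort h)
unlift k (lref i)   = mapMaybe lref (unliftVar k i)
unlift k (abst W T) = zipWith abst (unlift k W) (unlift (suc k) T)
unlift k (abbr V T) = zipWith abbr (unlift k V) (unlift (suc k) T)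
unlift k (appl V T) = zipWith appl (unlift k V) (unlift k T)
unlift k (cast W T) = zipWith cast (unlift k W) (unlift k T)

unliftVar-liftVar : ∀ k i → unliftVar k (liftVar 1 k i) ≡ just i
unliftVar-liftVar zero    i       = refl
unliftVar-liftVar (suc k) zero    = refl
unliftVar-liftVar (suc k) (suc i) = cong (mapMaybe suc) (unliftVar-liftVar k i)

unlift-lift : ∀ k T → unlift k (lift 1 k T) ≡ just T
unlift-lift k (sort h)   = refl
unlift-lift k (lref i)   =
  trans (cong (unlift k) (lift-lref 1 k i)) (cong (mapMaybe lref) (unliftVar-liftVar k i))
unlift-lift k (abst W T) = cong₂ (zipWith abst) (unlift-lift k W) (unlift-lift (suc k) T)
unlift-lift k (abbr V T) = cong₂ (zipWith abbr) (unlift-lift k V) (unlift-lift (suc k) T)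
unlift-lift k (appl V T) = cong₂ (zipWith appl) (unlift-lift k V) (unlift-lift k T)
unlift-lift k (cast W T) = cong₂ (zipWith cast) (unlift-lift k W) (unlift-lift k T)

lift-injective : ∀ k → lift 1 k U ≡ lift 1 k U' → U ≡ U'
lift-injective {U} {U'} k e =
  just-injective (trans (sym (unlift-lift k U)) (trans (cong (unlift k) e) (unlift-lift k U')))

zipWith-just : ∀ {A B C : Set} (f : A → B → C) {x y c} → zipWith f x y ≡ just c →
               ∃[ a ] ∃[ b ] x ≡ just a × y ≡ just b × c ≡ f a b
zipWith-just f {just a}  {just b}  refl = a , b , refl , refl , refl
zipWith-just f {just a}  {nothing} ()
zipWith-just f {nothing}           ()

map-zipWith : ∀ {A B C : Set} {f : A → A} {g : B → B} {h : C → C} (c : A → B → C) →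
              (∀ a b → h (c a b) ≡ c (f a) (g b)) →
              ∀ x y → mapMaybe h (zipWith c x y) ≡ zipWith c (mapMaybe f x) (mapMaybe g y)
map-zipWith c hom (just a) (just b) = cong just (hom a b)
map-zipWith c hom (just a) nothing  = refl
map-zipWith c hom nothing  y        = refl

unliftVar-just : ∀ k i → unliftVar k i ≡ just j → i ≡ liftVar 1 k j
unliftVar-just zero    (suc i) refl = refl
unliftVar-just (suc k) zero    refl = refl
unliftVar-just (suc k) (suc i) e with unliftVar k i in e'
unliftVar-just (suc k) (suc i) refl | just _ = cong suc (unliftVar-just k i e')

unlift-just : ∀ k T → unlift k T ≡ just U → T ≡ lift 1 k U
unlift-just k (sort h) refl = refl
unlift-just k (lref i) e with unliftVar k i in e'
unlift-just k (lref i) refl | just j = trans (cong lref (unliftVar-just k i e')) (sym (lift-lref 1 k j))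
unlift-just k (abst W T) e with zipWith-just abst e
... | _ , _ , eW , eT , refl = cong₂ abst (unlift-just k W eW) (unlift-just (suc k) T eT)
unlift-just k (abbr V T) e with zipWith-just abbr e
... | _ , _ , eV , eT , refl = cong₂ abbr (unlift-just k V eV) (unlift-just (suc k) T eT)
unlift-just k (appl V T) e with zipWith-just appl e
... | _ , _ , eV , eT , refl = cong₂ appl (unlift-just k V eV) (unlift-just k T eT)
unlift-just k (cast W T) e with zipWith-just cast e
... | _ , _ , eW , eT , refl = cong₂ cast (unlift-just k W eW) (unlift-just k T eT)

unliftVar-liftVar-suc : ∀ d j k i → j ≤ k →
  unliftVar j (liftVar d (suc k) i) ≡ mapMaybe (liftVar d k) (unliftVar j i)
unliftVar-liftVar-suc d zero    k       zero    _ = refl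
unliftVar-liftVar-suc d zero    k       (suc i) _ = refl
unliftVar-liftVar-suc d (suc j) (suc k) zero    _ = refl
unliftVar-liftVar-suc d (suc j) (suc k) (suc i) (s≤s p)
  rewrite unliftVar-liftVar-suc d j k i p with unliftVar j i
... | nothing = refl
... | just _  = refl

unlift-lift-suc : ∀ d j k T → j ≤ k → unlift j (lift d (suc k) T) ≡ mapMaybe (lift d k) (unlift j T)
unlift-lift-suc d j k (sort h) p = refl
unlift-lift-suc d j k (lref i) p
  rewrite lift-lref d (suc k) i | unliftVar-liftVar-suc d j k i p with unliftVar j i
... | nothing = refl
... | just x  = cong just (sym (lift-lref d k x))
unlift-lift-suc d j k (abst W T) p
  rewrite unlift-lift-suc d j k W p | unlift-lift-suc d (suc j) (suc k) T (s≤s p) =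
  sym (map-zipWith abst (λ _ _ → refl) (unlift j W) (unlift (suc j) T))
unlift-lift-suc d j k (abbr V T) p
  rewrite unlift-lift-suc d j k V p | unlift-lift-suc d (suc j) (suc k) T (s≤s p) =
  sym (map-zipWith abbr (λ _ _ → refl) (unlift j V) (unlift (suc j) T))
unlift-lift-suc d j k (appl V T) p
  rewrite unlift-lift-suc d j k V p | unlift-lift-suc d j k T p =
  sym (map-zipWith appl (λ _ _ → refl) (unlift j V) (unlift j T))
unlift-lift-suc d j k (cast W T) p
  rewrite unlift-lift-suc d j k W p | unlift-lift-suc d j k T p =
  sym (map-zipWith cast (λ _ _ → refl) (unlift j W) (unlift j T))

lift-shift-inv : ∀ d k T → lift d (suc k) T ≡ lift 1 0 U →
                 ∃[ U₀ ] T ≡ lift 1 0 U₀ × U ≡ lift d k U₀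
lift-shift-inv {U} d k T e
  with unlift 0 T in eT
     | trans (sym (unlift-lift-suc d 0 k T z≤n)) (trans (cong (unlift 0) e) (unlift-lift 0 U))
... | just U₀ | e' = U₀ , unlift-just 0 T eT , sym (just-injective e')
... | nothing | ()

Lifted : Term → Set
Lifted T = ∃[ U ] T ≡ lift 1 0 U

lifted? : ∀ T → Dec (Lifted T)
lifted? T with unlift 0 T in e
... | just U  = yes (U , unlift-just 0 T e)
... | nothing = no λ (U , eq) → case trans (sym e) (trans (cong (unlift 0) eq) (unlift-lift 0 U)) of λ ()

-- Parallel reduction in a context

-- Entry i of a context describes the binder of de Bruijn index i: just V for
-- an abbreviation δx=V, nothing for an abstraction.  V is stored relative to
-- its own position, hence it is lifted by suc i when it replaces lref i.
Ctx : Set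
Ctx = List (Maybe Term)

entry : Ctx → ℕ → Maybe Term
entry []      i       = nothing
entry (e ∷ Γ) zero    = e
entry (e ∷ Γ) (suc i) = entry Γ i

private variable
  Γ Γ' Γ₁ Γ₂ : Ctx

-- The side condition of ζ is an equation, so that matching on a derivation
-- never has to unify an index with a lift.
data Par : Ctx → Term → Term → Set where
  p-sort   : Par Γ (sort h) (sort h)
  p-lref   : Par Γ (lref i) (lref i)
  p-unfold : entry Γ i ≡ just V → Par Γ (lref i) (lift (suc i) 0 V)
  p-abst   : Par Γ W W' → Par (nothing ∷ Γ) T T' → Par Γ (abst W T) (abst W' T')
  p-abbr   : Par Γ V V' → Par (just V' ∷ Γ) T T' → Par Γ (abbr V T) (abbr V' T')
  p-appl   : Par Γ V V' → Par Γ T T' → Par Γ (appl V T) (appl V' T')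
  p-cast   : Par Γ W W' → Par Γ T T' → Par Γ (cast W T) (cast W' T')
  p-β      : Par Γ V V' → Par (just V' ∷ Γ) T T' → Par Γ (appl V (abst W T)) (abbr V' T')
  p-ζ      : T ≡ lift 1 0 U → Par Γ U U' → Par Γ (abbr V T) U'
  p-τ      : Par Γ T T' → Par Γ (cast W T) T'
  p-υ      : Par Γ V V' → Par Γ W W' → Par (just W' ∷ Γ) T T' →
             Par Γ (appl V (abbr W T)) (abbr W' (appl (lift 1 0 V') T'))

par-refl : ∀ T → Par Γ T T
par-refl (sort h)   = p-sort
par-refl (lref i)   = p-lref
par-refl (abst W T) = p-abst (par-refl W) (par-refl T)
par-refl (abbr V T) = p-abbr (par-refl V) (par-refl T)
par-refl (appl V T) = p-appl (par-refl V) (par-refl T)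
par-refl (cast W T) = p-cast (par-refl W) (par-refl T)

data Insert : ℕ → Ctx → Ctx → Set where
  here  : ∀ e → Insert 0 Γ (e ∷ Γ)
  under : ∀ e → Insert k Γ Γ' → Insert (suc k) (e ∷ Γ) (mapMaybe (lift 1 k) e ∷ Γ')

insert-entry-just : Insert k Γ Γ' → entry Γ i ≡ just V →
  ∃[ V' ] entry Γ' (liftVar 1 k i) ≡ just V' × lift 1 k (lift (suc i) 0 V) ≡ lift (suc (liftVar 1 k i)) 0 V'
insert-entry-just {i = i} {V = V} (here e) eq = V , eq , lift-lift 1 (suc i) 0 V
insert-entry-just {i = zero} (under nothing ins) ()
insert-entry-just {k = suc k} {i = zero} (under (just W) ins) refl = lift 1 k W , refl , lift-comm-shift₀ 1 k W
insert-entry-just {k = suc k} {i = suc i} {V = V} (under e ins) eq with insert-entry-just ins eq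
... | V' , eq' , eqV = V' , eq' , lift-under eqV
  where
  open ≡-Reasoning
  lift-under : ∀ {m n} → lift 1 k (lift m 0 V) ≡ lift n 0 V' →
               lift 1 (suc k) (lift (suc m) 0 V) ≡ lift (suc n) 0 V'
  lift-under {m} {n} eqV = begin
    lift 1 (suc k) (lift (suc m) 0 V)      ≡⟨ cong (lift 1 (suc k)) (sym (lift-lift 1 m 0 V)) ⟩
    lift 1 (suc k) (lift 1 0 (lift m 0 V)) ≡⟨ lift-comm-shift₀ 1 k (lift m 0 V) ⟩
    lift 1 0 (lift 1 k (lift m 0 V))       ≡⟨ cong (lift 1 0) eqV ⟩
    lift 1 0 (lift n 0 V')                 ≡⟨ lift-lift 1 n 0 V' ⟩
    lift (suc n) 0 V'                      ∎

insert-entry-nothing : Insert k Γ Γ' → entry Γ i ≡ nothing → entry Γ' (liftVar 1 k i) ≡ nothing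
insert-entry-nothing (here e) eq = eq
insert-entry-nothing {i = zero} (under nothing ins) eq = refl
insert-entry-nothing {i = suc i} (under e ins) eq = insert-entry-nothing ins eq

par-lift : Insert k Γ Γ' → Par Γ A B → Par Γ' (lift 1 k A) (lift 1 k B)
par-lift ins p-sort = p-sort
par-lift ins p-lref = par-refl _
par-lift {k = k} {Γ' = Γ'} ins (p-unfold {i = i} e) with insert-entry-just ins e
... | V' , e' , eq = subst₂ (Par Γ') (sym (lift-lref 1 k i)) (sym eq) (p-unfold e')
par-lift ins (p-abst a b) = p-abst (par-lift ins a) (par-lift (under _ ins) b)
par-lift ins (p-abbr a b) = p-abbr (par-lift ins a) (par-lift (under _ ins) b)
par-lift ins (p-appl a b) = p-appl (par-lift ins a) (par-lift ins b)
par-lift ins (p-cast a b) = p-cast (par-lift ins a) (par-lift ins b)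
par-lift ins (p-β a b) = p-β (par-lift ins a) (par-lift (under _ ins) b)
par-lift {k = k} ins (p-ζ {U = U} refl a) = p-ζ (lift-comm-shift₀ 1 k U) (par-lift ins a)
par-lift ins (p-τ a) = p-τ (par-lift ins a)
par-lift {k = k} {Γ' = Γ'} ins (p-υ {V' = V'} {W' = W'} {T' = T'} a b c) =
  subst (λ X → Par Γ' _ (abbr (lift 1 k W') (appl X (lift 1 (suc k) T')))) (sym (lift-comm-shift₀ 1 k V'))
    (p-υ (par-lift ins a) (par-lift ins b) (par-lift (under _ ins) c))

par-weaken : ∀ e → Par Γ A B → Par (e ∷ Γ) (lift 1 0 A) (lift 1 0 B)
par-weaken e = par-lift (here e)

LiftedReduct : ℕ → Ctx → Term → Term → Set
LiftedReduct k Γ A X = ∃[ B ] X ≡ lift 1 k B × Par Γ A B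

appl-reduct : LiftedReduct k Γ V V' → LiftedReduct k Γ T T' → LiftedReduct k Γ (appl V T) (appl V' T')
appl-reduct (V₁ , refl , a) (T₁ , refl , b) = appl V₁ T₁ , refl , p-appl a b

par-lift-inv-lref : Insert k Γ Γ' → ∀ i → Par Γ' (lref (liftVar 1 k i)) X → LiftedReduct k Γ (lref i) X
par-lift-inv-lref {k = k} ins i p-lref = lref i , sym (lift-lref 1 k i) , p-lref
par-lift-inv-lref {Γ = Γ} ins i (p-unfold e') with entry Γ i in e
... | just V with insert-entry-just ins e
...   | V' , e'' , eq with trans (sym e') e''
...     | refl = lift (suc i) 0 V , sym eq , p-unfold e
par-lift-inv-lref {Γ = Γ} ins i (p-unfold e') | nothing
  with () ← trans (sym e') (insert-entry-nothing ins e)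

par-lift-inv : Insert k Γ Γ' → ∀ A → Par Γ' (lift 1 k A) X → LiftedReduct k Γ A X
par-lift-inv ins (sort h) p-sort = sort h , refl , p-sort
par-lift-inv {k = k} ins (lref i) r rewrite lift-lref 1 k i = par-lift-inv-lref ins i r
par-lift-inv ins (abst W T) (p-abst a b) with par-lift-inv ins W a | par-lift-inv (under nothing ins) T b
... | W₁ , refl , a' | T₁ , refl , b' = abst W₁ T₁ , refl , p-abst a' b'
par-lift-inv ins (abbr V T) (p-abbr a b) with par-lift-inv ins V a
... | V₁ , refl , a' with par-lift-inv (under (just V₁) ins) T b
... | T₁ , refl , b' = abbr V₁ T₁ , refl , p-abbr a' b'
par-lift-inv {k = k} ins (abbr V T) (p-ζ {U = U} e a) with lift-shift-inv {U = U} 1 k T e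
... | U₀ , eT , refl with par-lift-inv ins U₀ a
... | U₁ , refl , a' = U₁ , refl , p-ζ eT a'
par-lift-inv ins (appl V (sort h)) (p-appl a b) = appl-reduct (par-lift-inv ins V a) (par-lift-inv ins _ b)
par-lift-inv {k = k} ins (appl V (lref i)) r rewrite lift-lref 1 k i with r
... | p-appl a b = appl-reduct (par-lift-inv ins V a) (par-lift-inv-lref ins i b)
par-lift-inv ins (appl V (abst W T)) (p-appl a b) = appl-reduct (par-lift-inv ins V a) (par-lift-inv ins _ b)
par-lift-inv ins (appl V (abst W T)) (p-β a b) with par-lift-inv ins V a
... | V₁ , refl , a' with par-lift-inv (under (just V₁) ins) T b
... | T₁ , refl , b' = abbr V₁ T₁ , refl , p-β a' b'
par-lift-inv ins (appl V (abbr W T)) (p-appl a b) = appl-reduct (par-lift-inv ins V a) (par-lift-inv ins _ b)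
par-lift-inv {k = k} ins (appl V (abbr W T)) (p-υ a b c) with par-lift-inv ins V a | par-lift-inv ins W b
... | V₁ , refl , a' | W₁ , refl , b' with par-lift-inv (under (just W₁) ins) T c
... | T₁ , refl , c' = abbr W₁ (appl (lift 1 0 V₁) T₁) ,
      cong (λ X → abbr (lift 1 k W₁) (appl X (lift 1 (suc k) T₁))) (sym (lift-comm-shift₀ 1 k V₁)) ,
      p-υ a' b' c'
par-lift-inv ins (appl V (appl _ _)) (p-appl a b) = appl-reduct (par-lift-inv ins V a) (par-lift-inv ins _ b)
par-lift-inv ins (appl V (cast _ _)) (p-appl a b) = appl-reduct (par-lift-inv ins V a) (par-lift-inv ins _ b)
par-lift-inv ins (cast W T) (p-cast a b) with par-lift-inv ins W a | par-lift-inv ins T b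
... | W₁ , refl , a' | T₁ , refl , b' = cast W₁ T₁ , refl , p-cast a' b'
par-lift-inv ins (cast W T) (p-τ a) with par-lift-inv ins T a
... | T₁ , refl , a' = T₁ , refl , p-τ a'

-- Complete developments and confluence

-- The heads T at which the development of appl V T contracts nothing: an
-- abbreviation with a lifted body is ζ-contracted instead of υ-contracted.
data Inert : Term → Set where
  inert-sort : Inert (sort h)
  inert-lref : Inert (lref i)
  inert-appl : Inert (appl V T)
  inert-cast : Inert (cast W T)
  inert-ζ    : Lifted T → Inert (abbr W T)

data Dev : Ctx → Term → Term → Set where
  d-sort   : Dev Γ (sort h) (sort h)
  d-unfold : entry Γ i ≡ just V → Dev Γ (lref i) (lift (suc i) 0 V)
  d-lref   : entry Γ i ≡ nothing → Dev Γ (lref i) (lref i)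
  d-abst   : Dev Γ W W' → Dev (nothing ∷ Γ) T T' → Dev Γ (abst W T) (abst W' T')
  d-ζ      : T ≡ lift 1 0 U → Dev Γ U U' → Dev Γ (abbr V T) U'
  d-abbr   : ¬ Lifted T → Dev Γ V V' → Dev (just V' ∷ Γ) T T' → Dev Γ (abbr V T) (abbr V' T')
  d-β      : Dev Γ V V' → Dev (just V' ∷ Γ) T T' → Dev Γ (appl V (abst W T)) (abbr V' T')
  d-υ      : ¬ Lifted T → Dev Γ V V' → Dev Γ W W' → Dev (just W' ∷ Γ) T T' →
             Dev Γ (appl V (abbr W T)) (abbr W' (appl (lift 1 0 V') T'))
  d-appl   : Inert T → Dev Γ V V' → Dev Γ T T' → Dev Γ (appl V T) (appl V' T')
  d-τ      : Dev Γ T T' → Dev Γ (cast W T) T'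

data ApplHead : Term → Set where
  β-redex : ∀ W T → ApplHead (abst W T)
  υ-redex : ∀ W T → ¬ Lifted T → ApplHead (abbr W T)
  inert   : Inert T → ApplHead T

applHead : ∀ T → ApplHead T
applHead (sort h)   = inert inert-sort
applHead (lref i)   = inert inert-lref
applHead (abst W T) = β-redex W T
applHead (abbr W T) with lifted? T
... | yes l = inert (inert-ζ l)
... | no nl = υ-redex W T nl
applHead (appl V T) = inert inert-appl
applHead (cast W T) = inert inert-cast

dev-exists : ∀ Γ T → Acc _<_ (size T) → ∃ (Dev Γ T)
dev-exists Γ (sort h) _ = sort h , d-sort
dev-exists Γ (lref i) _ with entry Γ i in e
... | just V  = lift (suc i) 0 V , d-unfold e
... | nothing = lref i , d-lref e
dev-exists Γ (abst W T) (acc rs)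
  with dev-exists Γ W (rs (m<1+m+n _ _)) | dev-exists (nothing ∷ Γ) T (rs (n<1+m+n _ _))
... | W' , dW | T' , dT = abst W' T' , d-abst dW dT
dev-exists Γ (abbr V T) (acc rs) with lifted? T
... | yes (U , e) with dev-exists Γ U (rs (subst (_< _) (trans (cong size e) (size-lift 1 0 U)) (n<1+m+n _ _)))
...   | U' , dU = U' , d-ζ e dU
dev-exists Γ (abbr V T) (acc rs) | no nl with dev-exists Γ V (rs (m<1+m+n _ _))
...   | V' , dV with dev-exists (just V' ∷ Γ) T (rs (n<1+m+n _ _))
...     | T' , dT = abbr V' T' , d-abbr nl dV dT
dev-exists Γ (appl V T) (acc rs) with dev-exists Γ V (rs (m<1+m+n _ _)) | applHead T
... | V' , dV | β-redex W B with dev-exists (just V' ∷ Γ) B (rs (<-trans (n<1+m+n _ _) (n<1+m+n _ _)))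
...   | B' , dB = abbr V' B' , d-β dV dB
dev-exists Γ (appl V T) (acc rs) | V' , dV | υ-redex W B nl
  with dev-exists Γ W (rs (<-trans (m<1+m+n _ _) (n<1+m+n _ _)))
...   | W' , dW with dev-exists (just W' ∷ Γ) B (rs (<-trans (n<1+m+n _ _) (n<1+m+n _ _)))
...     | B' , dB = abbr W' (appl (lift 1 0 V') B') , d-υ nl dV dW dB
dev-exists Γ (appl V T) (acc rs) | V' , dV | inert it with dev-exists Γ T (rs (n<1+m+n _ _))
...   | T' , dT = appl V' T' , d-appl it dV dT
dev-exists Γ (cast W T) (acc rs) with dev-exists Γ T (rs (n<1+m+n _ _))
... | T' , dT = T' , d-τ dT

-- A λ-entry of Γ₁ may face any entry of Γ₂, since Par Γ₁ never unfolds it.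
data ParCtx : Ctx → Ctx → Set where
  pc-[] : ParCtx [] []
  pc-λ  : ∀ {e} → ParCtx Γ₁ Γ₂ → ParCtx (nothing ∷ Γ₁) (e ∷ Γ₂)
  pc-δ  : ParCtx Γ₁ Γ₂ → Par Γ₂ V₁ V₂ → ParCtx (just V₁ ∷ Γ₁) (just V₂ ∷ Γ₂)

parCtx-refl : ∀ Γ → ParCtx Γ Γ
parCtx-refl []            = pc-[]
parCtx-refl (nothing ∷ Γ) = pc-λ (parCtx-refl Γ)
parCtx-refl (just V ∷ Γ)  = pc-δ (parCtx-refl Γ) (par-refl V)

par-weaken-lifted : ∀ e m → Par Γ (lift m 0 A) (lift m 0 B) →
                    Par (e ∷ Γ) (lift (suc m) 0 A) (lift (suc m) 0 B)
par-weaken-lifted {A = A} {B = B} e m p = subst₂ (Par _) (lift-lift 1 m 0 A) (lift-lift 1 m 0 B) (par-weaken e p)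

parCtx-entry : ParCtx Γ₁ Γ₂ → entry Γ₁ i ≡ just V₁ →
  ∃[ V₂ ] entry Γ₂ i ≡ just V₂ × Par Γ₂ (lift (suc i) 0 V₁) (lift (suc i) 0 V₂)
parCtx-entry {i = zero} (pc-δ {V₂ = V₂} s p) refl = V₂ , refl , par-weaken (just V₂) p
parCtx-entry {i = suc i} {V₁ = V₁} (pc-λ s) e with parCtx-entry s e
... | V₂ , e₂ , p = V₂ , e₂ , par-weaken-lifted {A = V₁} {B = V₂} _ (suc i) p
parCtx-entry {i = suc i} {V₁ = V₁} (pc-δ s _) e with parCtx-entry s e
... | V₂ , e₂ , p = V₂ , e₂ , par-weaken-lifted {A = V₁} {B = V₂} _ (suc i) p

triangle : ParCtx Γ₁ Γ₂ → Dev Γ₂ T T* → Par Γ₁ T T' → Par Γ₂ T' T*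
triangle s d-sort p-sort = p-sort
triangle s (d-unfold e) p-lref = p-unfold e
triangle s (d-unfold e) (p-unfold e₁) with parCtx-entry s e₁
... | _ , e₂ , p with refl ← trans (sym e₂) e = p
triangle s (d-lref e) p-lref = p-lref
triangle s (d-lref e) (p-unfold e₁) with parCtx-entry s e₁
... | _ , e₂ , _ with () ← trans (sym e₂) e
triangle s (d-abst dW dT) (p-abst a b) = p-abst (triangle s dW a) (triangle (pc-λ s) dT b)
triangle s (d-ζ {U = U} refl dU) (p-abbr a b) with par-lift-inv (here _) U b
... | _ , refl , b' = p-ζ refl (triangle s dU b')
triangle s (d-ζ {U = U} e dU) (p-ζ {U = U'} e' a)
  with refl ← lift-injective {U = U} {U' = U'} 0 (trans (sym e) e') = triangle s dU a
triangle s (d-abbr nl dV dT) (p-abbr a b) =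
  let pV = triangle s dV a in p-abbr pV (triangle (pc-δ s pV) dT b)
triangle s (d-abbr nl dV dT) (p-ζ {U = U} e a) = ⊥-elim (nl (U , e))
triangle s (d-β dV dT) (p-appl a (p-abst _ b)) = p-β (triangle s dV a) (triangle (pc-λ s) dT b)
triangle s (d-β dV dT) (p-β a b) =
  let pV = triangle s dV a in p-abbr pV (triangle (pc-δ s pV) dT b)
triangle s (d-υ nl dV dW dT) (p-appl a (p-abbr b c)) =
  let pW = triangle s dW b in p-υ (triangle s dV a) pW (triangle (pc-δ s pW) dT c)
triangle s (d-υ nl dV dW dT) (p-appl a (p-ζ {U = U} e b)) = ⊥-elim (nl (U , e))
triangle s (d-υ nl dV dW dT) (p-υ a b c) =
  let pW = triangle s dW b in p-abbr pW (p-appl (par-weaken _ (triangle s dV a)) (triangle (pc-δ s pW) dT c))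
triangle s (d-appl _ dV dT) (p-appl a b) = p-appl (triangle s dV a) (triangle s dT b)
triangle s (d-appl (inert-ζ (U , refl)) dV (d-ζ {U = U₀} e dU)) (p-υ a b c)
  with refl ← lift-injective {U = U} {U' = U₀} 0 e | par-lift-inv (here _) U c
... | _ , refl , c' = p-ζ refl (p-appl (triangle s dV a) (triangle s dU c'))
triangle s (d-appl (inert-ζ l) dV (d-abbr nl _ _)) (p-υ a b c) = ⊥-elim (nl l)
triangle s (d-τ dT) (p-cast a b) = p-τ (triangle s dT b)
triangle s (d-τ dT) (p-τ a) = triangle s dT a

par-diamond : Par Γ T T₁ → Par Γ T T₂ → ∃[ T₃ ] Par Γ T₁ T₃ × Par Γ T₂ T₃
par-diamond {Γ} {T} a b with dev-exists Γ T (<-wellFounded (size T))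
... | T* , d = T* , triangle (parCtx-refl Γ) d a , triangle (parCtx-refl Γ) d b

par-confluent : Confluent (Par Γ)
par-confluent = diamond⇒confluent par-diamond

par*-abst-inv : Star (Par Γ) (abst V T) X →
  ∃[ V' ] ∃[ T' ] X ≡ abst V' T' × Star (Par Γ) V V' × Star (Par (nothing ∷ Γ)) T T'
par*-abst-inv ε = _ , _ , refl , ε , ε
par*-abst-inv (p-abst a b ◅ rs) with par*-abst-inv rs
... | V' , T' , eq , rV , rT = V' , T' , eq , a ◅ rV , b ◅ rT

-- Reduction steps in a context

data Step (Γ : Ctx) (T₁ T₂ : Term) : Set where
  free   : T₁ →₀ T₂ → Step Γ T₁ T₂
  unfold : entry Γ i ≡ just V → T₁ →₀ T → SSubst i (lift (suc i) 0 V) T T₂ → Step Γ T₁ T₂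

ps-refl : ∀ T → PSubst i W T T
ps-refl (sort h)   = ps-sort
ps-refl (lref j)   = ps-keep
ps-refl (abst A T) = ps-abst (ps-refl A) (ps-refl T)
ps-refl (abbr A T) = ps-abbr (ps-refl A) (ps-refl T)
ps-refl (appl A T) = ps-appl (ps-refl A) (ps-refl T)
ps-refl (cast A T) = ps-cast (ps-refl A) (ps-refl T)

ssubst⇒psubst : SSubst i W A B → PSubst i W A B
ssubst⇒psubst ss-repl        = ps-repl
ssubst⇒psubst (ss-abstˡ a b) = ps-abst (ssubst⇒psubst a) b
ssubst⇒psubst (ss-abstʳ a b) = ps-abst a (ssubst⇒psubst b)
ssubst⇒psubst (ss-abbrˡ a b) = ps-abbr (ssubst⇒psubst a) b
ssubst⇒psubst (ss-abbrʳ a b) = ps-abbr a (ssubst⇒psubst b)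
ssubst⇒psubst (ss-applˡ a b) = ps-appl (ssubst⇒psubst a) b
ssubst⇒psubst (ss-applʳ a b) = ps-appl a (ssubst⇒psubst b)
ssubst⇒psubst (ss-castˡ a b) = ps-cast (ssubst⇒psubst a) b
ssubst⇒psubst (ss-castʳ a b) = ps-cast a (ssubst⇒psubst b)

ssubst-shift : SSubst (suc i) (lift (suc (suc i)) 0 V) A B → SSubst (suc i) (lift 1 0 (lift (suc i) 0 V)) A B
ssubst-shift {i = i} {V = V} = subst (λ W → SSubst (suc i) W _ _) (sym (lift-lift 1 (suc i) 0 V))

step-abstˡ : Step Γ W W' → Step Γ (abst W T) (abst W' T)
step-abstˡ (free r)        = free (r-abst r r-refl)
step-abstˡ (unfold e r ss) = unfold e (r-abst r r-refl) (ss-abstˡ ss (ps-refl _))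

step-abstʳ : Step (nothing ∷ Γ) T T' → Step Γ (abst W T) (abst W T')
step-abstʳ (free r) = free (r-abst r-refl r)
step-abstʳ (unfold {i = zero} () _ _)
step-abstʳ (unfold {i = suc i} {V} e r ss) =
  unfold e (r-abst r-refl r) (ss-abstʳ (ps-refl _) (ssubst-shift {V = V} ss))

step-abbrˡ : Step Γ V V' → Step Γ (abbr V T) (abbr V' T)
step-abbrˡ (free r)        = free (r-abbr r r-refl)
step-abbrˡ (unfold e r ss) = unfold e (r-abbr r r-refl) (ss-abbrˡ ss (ps-refl _))

step-abbrʳ : Step (just V ∷ Γ) T T' → Step Γ (abbr V T) (abbr V T')
step-abbrʳ (free r) = free (r-abbr r-refl r)
step-abbrʳ (unfold {i = zero} refl r ss) = free (r-delta r-refl r ss)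
step-abbrʳ (unfold {i = suc i} {V} e r ss) =
  unfold e (r-abbr r-refl r) (ss-abbrʳ (ps-refl _) (ssubst-shift {V = V} ss))

step-applˡ : Step Γ V V' → Step Γ (appl V T) (appl V' T)
step-applˡ (free r)        = free (r-appl r r-refl)
step-applˡ (unfold e r ss) = unfold e (r-appl r r-refl) (ss-applˡ ss (ps-refl _))

step-applʳ : Step Γ T T' → Step Γ (appl V T) (appl V T')
step-applʳ (free r)        = free (r-appl r-refl r)
step-applʳ (unfold e r ss) = unfold e (r-appl r-refl r) (ss-applʳ (ps-refl _) ss)

step-castˡ : Step Γ W W' → Step Γ (cast W T) (cast W' T)
step-castˡ (free r)        = free (r-cast r r-refl)
step-castˡ (unfold e r ss) = unfold e (r-cast r r-refl) (ss-castˡ ss (ps-refl _))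

step-castʳ : Step Γ T T' → Step Γ (cast W T) (cast W T')
step-castʳ (free r)        = free (r-cast r-refl r)
step-castʳ (unfold e r ss) = unfold e (r-cast r-refl r) (ss-castʳ (ps-refl _) ss)

psubst⇒par : PSubst i W A B → entry Γ i ≡ just V → W ≡ lift (suc i) 0 V → Par Γ A B
psubst⇒par ps-sort e _    = p-sort
psubst⇒par ps-keep e _    = p-lref
psubst⇒par ps-repl e refl = p-unfold e
psubst⇒par {i = i} {V = V} (ps-abst a b) e eW =
  p-abst (psubst⇒par a e eW) (psubst⇒par b e (trans (cong (lift 1 0) eW) (lift-lift 1 (suc i) 0 V)))
psubst⇒par {i = i} {V = V} (ps-abbr a b) e eW =
  p-abbr (psubst⇒par a e eW) (psubst⇒par b e (trans (cong (lift 1 0) eW) (lift-lift 1 (suc i) 0 V)))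
psubst⇒par (ps-appl a b) e eW = p-appl (psubst⇒par a e eW) (psubst⇒par b e eW)
psubst⇒par (ps-cast a b) e eW = p-cast (psubst⇒par a e eW) (psubst⇒par b e eW)

star-cong₂ : ∀ {Δ : Term → Ctx} (f : Term → Term → Term) →
  (∀ {A A' T} → Par Γ A A' → Par Γ (f A T) (f A' T)) →
  (∀ {A T T'} → Par (Δ A) T T' → Par Γ (f A T) (f A T')) →
  Star (Par Γ) A A' → Star (Par (Δ A)) T T' → Star (Par Γ) (f A T) (f A' T')
star-cong₂ f congˡ congʳ rA rT = Star.gmap (f _) congʳ rT ◅◅ Star.gmap (λ x → f x _) congˡ rA

star-abst : Star (Par Γ) W W' → Star (Par (nothing ∷ Γ)) T T' → Star (Par Γ) (abst W T) (abst W' T')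
star-abst = star-cong₂ abst (λ p → p-abst p (par-refl _)) (p-abst (par-refl _))

star-abbr : Star (Par Γ) V V' → Star (Par (just V ∷ Γ)) T T' → Star (Par Γ) (abbr V T) (abbr V' T')
star-abbr = star-cong₂ abbr (λ p → p-abbr p (par-refl _)) (p-abbr (par-refl _))

star-appl : Star (Par Γ) V V' → Star (Par Γ) T T' → Star (Par Γ) (appl V T) (appl V' T')
star-appl = star-cong₂ appl (λ p → p-appl p (par-refl _)) (p-appl (par-refl _))

star-cast : Star (Par Γ) W W' → Star (Par Γ) T T' → Star (Par Γ) (cast W T) (cast W' T')
star-cast = star-cong₂ cast (λ p → p-cast p (par-refl _)) (p-cast (par-refl _))

→₀⇒par* : A →₀ B → Star (Par Γ) A B
→₀⇒par* r-refl           = ε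
→₀⇒par* (r-abst a b)     = star-abst (→₀⇒par* a) (→₀⇒par* b)
→₀⇒par* (r-abbr a b)     = star-abbr (→₀⇒par* a) (→₀⇒par* b)
→₀⇒par* (r-appl a b)     = star-appl (→₀⇒par* a) (→₀⇒par* b)
→₀⇒par* (r-cast a b)     = star-cast (→₀⇒par* a) (→₀⇒par* b)
→₀⇒par* (r-beta a b)     = p-β (par-refl _) (par-refl _) ◅ star-abbr (→₀⇒par* a) (→₀⇒par* b)
→₀⇒par* (r-delta a b ss) =
  star-abbr (→₀⇒par* a) (→₀⇒par* b) ◅◅
  p-abbr (par-refl _) (psubst⇒par (ssubst⇒psubst ss) refl refl) ◅ ε
→₀⇒par* (r-zeta a)       = p-ζ refl (par-refl _) ◅ →₀⇒par* a
→₀⇒par* (r-tau a)        = p-τ (par-refl _) ◅ →₀⇒par* a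
→₀⇒par* (r-upsilon a b c) =
  p-υ (par-refl _) (par-refl _) (par-refl _) ◅
  star-abbr (→₀⇒par* b) (star-appl (Star.gmap (lift 1 0) (par-weaken _) (→₀⇒par* a)) (→₀⇒par* c))

step⇒par* : Step Γ A B → Star (Par Γ) A B
step⇒par* (free r)        = →₀⇒par* r
step⇒par* (unfold e r ss) = →₀⇒par* r ◅◅ psubst⇒par (ssubst⇒psubst ss) e refl ◅ ε

conv-cong₂ : ∀ {Δ : Term → Ctx} (f : Term → Term → Term) →
  (∀ {A A' T} → Step Γ A A' → Step Γ (f A T) (f A' T)) →
  (∀ {A T T'} → Step (Δ A) T T' → Step Γ (f A T) (f A T')) →
  EqClosure (Step Γ) A A' → EqClosure (Step (Δ A')) T T' → EqClosure (Step Γ) (f A T) (f A' T')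
conv-cong₂ f congˡ congʳ cA cT = EqClosure.gmap (λ x → f x _) congˡ cA ◅◅ EqClosure.gmap (f _) congʳ cT

abbr-conv : EqClosure (Step Γ) V V' → EqClosure (Step (just V' ∷ Γ)) T T' →
            EqClosure (Step Γ) (abbr V T) (abbr V' T')
abbr-conv = conv-cong₂ abbr step-abbrˡ step-abbrʳ

par⇒conv : Par Γ A B → EqClosure (Step Γ) A B
par⇒conv p-sort       = ε
par⇒conv p-lref       = ε
par⇒conv (p-unfold e) = EqClosure.return (unfold e r-refl ss-repl)
par⇒conv (p-abst a b) = conv-cong₂ abst step-abstˡ step-abstʳ (par⇒conv a) (par⇒conv b)
par⇒conv (p-abbr a b) = abbr-conv (par⇒conv a) (par⇒conv b)
par⇒conv (p-appl a b) = conv-cong₂ appl step-applˡ step-applʳ (par⇒conv a) (par⇒conv b)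
par⇒conv (p-cast a b) = conv-cong₂ cast step-castˡ step-castʳ (par⇒conv a) (par⇒conv b)
par⇒conv (p-β a b) = EqClosure.return (free (r-beta r-refl r-refl)) ◅◅ abbr-conv (par⇒conv a) (par⇒conv b)
par⇒conv (p-ζ refl a) = EqClosure.return (free (r-zeta r-refl)) ◅◅ par⇒conv a
par⇒conv (p-τ a) = EqClosure.return (free (r-tau r-refl)) ◅◅ par⇒conv a
par⇒conv (p-υ a b c) =
  conv-cong₂ appl step-applˡ step-applʳ (par⇒conv a) (abbr-conv (par⇒conv b) (par⇒conv c)) ◅◅
  EqClosure.return (free (r-upsilon r-refl r-refl r-refl))

ctxFrom : Ctx → Env → Ctx
ctxFrom Γ (esort h)   = Γ
ctxFrom Γ (eabst W E) = ctxFrom (nothing ∷ Γ) E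
ctxFrom Γ (eabbr V E) = ctxFrom (just V ∷ Γ) E
ctxFrom Γ (eappl V E) = ctxFrom Γ E
ctxFrom Γ (ecast W E) = ctxFrom Γ E

ctx : Env → Ctx
ctx = ctxFrom []

ctxFrom-plug : ∀ Γ C F → ctxFrom Γ (plug C F) ≡ ctxFrom (ctxFrom Γ C) F
ctxFrom-plug Γ (esort h)   F = refl
ctxFrom-plug Γ (eabst W C) F = ctxFrom-plug _ C F
ctxFrom-plug Γ (eabbr V C) F = ctxFrom-plug _ C F
ctxFrom-plug Γ (eappl V C) F = ctxFrom-plug _ C F
ctxFrom-plug Γ (ecast W C) F = ctxFrom-plug _ C F

ctx-λ : ∀ E W → ctx (E ·λ W) ≡ nothing ∷ ctx E
ctx-λ E W = ctxFrom-plug [] E _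

entry-ctxFrom : ∀ Γ C i → entry (ctxFrom Γ C) (i + binders C) ≡ entry Γ i
entry-ctxFrom Γ (esort h)   i = cong (entry Γ) (+-identityʳ i)
entry-ctxFrom Γ (eabst W C) i =
  trans (cong (entry (ctxFrom (nothing ∷ Γ) C)) (+-suc i (binders C))) (entry-ctxFrom (nothing ∷ Γ) C (suc i))
entry-ctxFrom Γ (eabbr V C) i =
  trans (cong (entry (ctxFrom (just V ∷ Γ) C)) (+-suc i (binders C))) (entry-ctxFrom (just V ∷ Γ) C (suc i))
entry-ctxFrom Γ (eappl V C) i = entry-ctxFrom Γ C i
entry-ctxFrom Γ (ecast W C) i = entry-ctxFrom Γ C i

entry-ctx-δ : ∀ C₁ V C₂ → entry (ctx (C₁ ·δ V · C₂)) (binders C₂) ≡ just V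
entry-ctx-δ C₁ V C₂ =
  trans (cong (λ Γ → entry Γ (binders C₂)) (ctxFrom-plug [] C₁ _)) (entry-ctxFrom (just V ∷ ctx C₁) C₂ 0)

DeltaAt : Env → ℕ → Term → Set
DeltaAt E i V = ∃[ C₁ ] ∃[ C₂ ] E ≡ C₁ ·δ V · C₂ × binders C₂ ≡ i

entry-ctxFrom-inv : ∀ Γ E i → entry (ctxFrom Γ E) i ≡ just V →
  DeltaAt E i V ⊎ ∃[ j ] i ≡ j + binders E × entry Γ j ≡ just V
entry-ctxFrom-inv Γ (esort h) i e = inj₂ (i , sym (+-identityʳ i) , e)
entry-ctxFrom-inv Γ (eabst W E) i e with entry-ctxFrom-inv (nothing ∷ Γ) E i e
... | inj₁ (C₁ , C₂ , eq , b)  = inj₁ (eabst W C₁ , C₂ , cong (eabst W) eq , b)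
... | inj₂ (suc j , eqi , e') = inj₂ (j , trans eqi (sym (+-suc j (binders E))) , e')
entry-ctxFrom-inv Γ (eabbr V E) i e with entry-ctxFrom-inv (just V ∷ Γ) E i e
... | inj₁ (C₁ , C₂ , eq , b)  = inj₁ (eabbr V C₁ , C₂ , cong (eabbr V) eq , b)
... | inj₂ (zero , eqi , refl) = inj₁ (esort 0 , E , refl , sym eqi)
... | inj₂ (suc j , eqi , e')  = inj₂ (j , trans eqi (sym (+-suc j (binders E))) , e')
entry-ctxFrom-inv Γ (eappl V E) i e =
  mapˡ (λ (C₁ , C₂ , eq , b) → eappl V C₁ , C₂ , cong (eappl V) eq , b) (entry-ctxFrom-inv Γ E i e)
entry-ctxFrom-inv Γ (ecast W E) i e =
  mapˡ (λ (C₁ , C₂ , eq , b) → ecast W C₁ , C₂ , cong (ecast W) eq , b) (entry-ctxFrom-inv Γ E i e)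

entry-ctx-inv : ∀ E → entry (ctx E) i ≡ just V → DeltaAt E i V
entry-ctx-inv E e with entry-ctxFrom-inv [] E _ e
... | inj₁ δ = δ

step⇒Step : E ⊢ A ⟶ B → Step (ctx E) A B
step⇒Step (red-free r)                      = free r
step⇒Step (red-env {C₁} {C₂} {V} refl r ss) = unfold (entry-ctx-δ C₁ V C₂) r ss

Step⇒step : Step (ctx E) A B → E ⊢ A ⟶ B
Step⇒step (free r) = red-free r
Step⇒step {E} (unfold e r ss) with entry-ctx-inv E e
... | _ , _ , eq , refl = red-env eq r ss

⇔-isEquivalence : IsEquivalence (E ⊢_⇔_)
⇔-isEquivalence = record { refl = cv-step (red-free r-refl) ; sym = cv-sym ; trans = cv-trans }

⇔⇒conv : E ⊢ A ⇔ B → EqClosure (Step (ctx E)) A B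
⇔⇒conv (cv-step s)     = EqClosure.return (step⇒Step s)
⇔⇒conv (cv-sym c)      = EqClosure.symmetric _ (⇔⇒conv c)
⇔⇒conv (cv-trans c c') = ⇔⇒conv c ◅◅ ⇔⇒conv c'

conv⇒⇔ : ctx E ≡ Γ → EqClosure (Step Γ) A B → E ⊢ A ⇔ B
conv⇒⇔ refl = EqClosure.fold ⇔-isEquivalence (cv-step ∘ Step⇒step)

⇔⇒par-joinable : E ⊢ A ⇔ B → ∃[ D ] Star (Par (ctx E)) A D × Star (Par (ctx E)) B D
⇔⇒par-joinable = church-rosser par-confluent ∘ ((a—↠b⇒a↔b ∘ step⇒par*) ⋆) ∘ ⇔⇒conv

par-joinable⇒⇔ : ctx E ≡ Γ → Star (Par Γ) A D → Star (Par Γ) B D → E ⊢ A ⇔ B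
par-joinable⇒⇔ eq r r' = conv⇒⇔ eq ((par⇒conv ⋆) (a—↠b⇒a↔b r ◅◅ a—↠b⇒b↔a r'))

mainTheorem3 : ∀ (C : Env) (V₁ V₂ T₁ T₂ : Term) →
    C ⊢ abst V₁ T₁ ⇔ abst V₂ T₂ →
    (C ⊢ V₁ ⇔ V₂) × (∀ (V : Term) → (C ·λ V) ⊢ T₁ ⇔ T₂)
mainTheorem3 C V₁ V₂ T₁ T₂ conv with ⇔⇒par-joinable conv
... | _ , r₁ , r₂ with par*-abst-inv r₁ | par*-abst-inv r₂
... | _ , _ , refl , rV₁ , rT₁ | _ , _ , refl , rV₂ , rT₂ =
  par-joinable⇒⇔ refl rV₁ rV₂ , λ V → par-joinable⇒⇔ (ctx-λ C V) rT₁ rT₂
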